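{- Let $M$ be a countable structure and let $\mathcal{A}=\{M_i:i\in N\}$ be an $(M,M';\bar N;\Psi)$-system in $M$. If $\bar N$ is $\aleph_0$-categorical and each $M_i$ is $\aleph_0$-categorical over $\Psi_{i,i}$, then for each $n\ge1$ the set $(M')^n$ meets only finitely many orbits of $\mathrm{Aut}(M)$ acting on $M^n$ (i.e. $|(M')^n/\sim_{M,n}|<\aleph_0$, where $\underline a\sim_{M,n}\underline b$ iff $\underline a\phi=\underline b$ for some $\phi\in\mathrm{Aut}(M)$).
   Context: Definition of $(M,M';\bar N;\Psi)$-system: $M$ is a structure with a fixed substructure $M'$; $\{M_i:i\in N\}$ is a set of substructures of $M'$ with $M'=\bigcup_{i\in N}M_i$, indexed by (the domain of) a structure $N$; $N_1,\dots,N_r$ is a finite partition of $N$ and $\bar N=(N;N_1,\dots,N_r)$ is the set extension of $N$ by unary relations $N_1,\dots,N_r$ (automorphisms of $\bar N$ are automorphisms of $N$ fixing each $N_k$ setwise). For $i,j\in N$, $\Psi_{i,j}$ is a subset of the set of isomorphisms $M_i\to M_j$ such that: (1) if $i,j\in N_k$ for some $k$ then $\Psi_{i,j}\ne\emptyset$; (2) if $\phi\in\Psi_{i,j}$, $\phi'\in\Psi_{j,\ell}$ then $\phi\phi'\in\Psi_{i,\ell}$; (3) if $\phi\in\Psi_{i,j}$ then $\phi^{ -1}\in\Psi_{j,i}$; (4) if $\pi\in\mathrm{Aut}(\bar N)$ and $\phi_i\in\Psi_{i,i\pi}$ for each $i\in N$, then some automorphism of $M$ extends every $\phi_i$. $\Psi=\bigcup_{i,j}\Psi_{i,j}$.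 (These conditions make each $\Psi_{i,i}$ a subgroup of $\mathrm{Aut}(M_i)$.) A structure $K$ is $\aleph_0$-categorical over a subgroup $\Phi\le\mathrm{Aut}(K)$ if $\Phi$ has finitely many orbits on $K^n$ for each $n\ge1$; a countable structure is $\aleph_0$-categorical iff it is $\aleph_0$-categorical over its full automorphism group. -}

module Defs where

open import Data.Nat using (ℕ; _≤_)
open import Data.Fin using (Fin)
open import Data.Unit using (⊤)
import Data.Product
open import Data.Vec using (Vec; map)
open import Data.Vec.Relation.Unary.All using (All)
open import Data.List using (List)
open import Data.List.Relation.Unary.Any using (Any)
open import Data.Product using (Σ; _×_; Σ-syntax)
open import Relation.Binary.PropositionalEquality using (_≡_)
open import Function using (_∘_)
open import Relation.Binary.PropositionalEquality using (trans; cong; sym; subst; refl)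
open import Data.Vec.Properties using (map-∘)
open import Data.Vec using ([]; _∷_)

allmap : ∀ {C : Set} {A B : C → Set} {f : C → C} →
         (∀ x → A x → B (f x)) → ∀ {n} {v : Vec C n} → All A v → All B (map f v)
allmap h All.[] = All.[]
allmap h (p All.∷ ps) = h _ p All.∷ allmap h ps

map-inv : ∀ {C : Set} {A : C → Set} {f g : C → C} →
          (∀ x → A x → f (g x) ≡ x) → ∀ {n} {v : Vec C n} → All A v → map f (map g v) ≡ v
map-inv h All.[] = refl
map-inv h (p All.∷ ps) = cong₂ _∷_ (h _ p) (map-inv h ps)
  where open import Relation.Binary.PropositionalEquality using (cong₂)

record Signature : Set₁ where
  field
    RelSym : Set
    rar    : RelSym → ℕ
    FunSym : Set          -- constants are 0-ary function symbols
    far    : FunSym → ℕ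

record Structure (L : Signature) : Set₁ where
  open Signature L
  field
    Carrier : Set
    rel     : (R : RelSym) → Vec Carrier (rar R) → Set
    fun     : (F : FunSym) → Vec Carrier (far F) → Carrier

module _ {L : Signature} (M : Structure L) where
  open Signature L
  open Structure M

  Countable : Set
  Countable = Σ (Carrier → ℕ) Injective' where
    Injective' : (Carrier → ℕ) → Set
    Injective' f = ∀ x y → f x ≡ f y → x ≡ y

  record Aut : Set where
    field
      to       : Carrier → Carrier
      from     : Carrier → Carrier
      from-to  : ∀ x → from (to x) ≡ x
      to-from  : ∀ y → to (from y) ≡ y
      rel-to   : ∀ R (v : Vec Carrier (rar R)) → rel R v → rel R (map to v)
      rel-from : ∀ R (v : Vec Carrier (rar R)) → rel R (map to v) → rel R v
      fun-pres : ∀ F (v : Vec Carrier (far F)) → to (fun F v) ≡ fun F (map to v)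

  IsSubstructure : (Carrier → Set) → Set
  IsSubstructure P = ∀ F (v : Vec Carrier (far F)) → All P v → P (fun F v)

  -- An isomorphism between the substructures with domains P and Q.
  -- It is represented by total maps on the carrier whose behaviour is only
  -- relevant on P (resp. Q).
  record SubIso (P Q : Carrier → Set) : Set where
    field
      to       : Carrier → Carrier
      from     : Carrier → Carrier
      to-in    : ∀ x → P x → Q (to x)
      from-in  : ∀ y → Q y → P (from y)
      from-to  : ∀ x → P x → from (to x) ≡ x
      to-from  : ∀ y → Q y → to (from y) ≡ y
      rel-to   : ∀ R (v : Vec Carrier (rar R)) → All P v → rel R v → rel R (map to v)
      rel-from : ∀ R (v : Vec Carrier (rar R)) → All P v → rel R (map to v) → rel R v
      fun-pres : ∀ F (v : Vec Carrier (far F)) → All P v → to (fun F v) ≡ fun F (map to v)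

  _⨾_ : ∀ {P Q S} → SubIso P Q → SubIso Q S → SubIso P S
  _⨾_ {P} {Q} {S} φ ψ = record
    { to = ψ.to ∘ φ.to
    ; from = φ.from ∘ ψ.from
    ; to-in = λ x p → ψ.to-in _ (φ.to-in x p)
    ; from-in = λ y s → φ.from-in _ (ψ.from-in y s)
    ; from-to = λ x p → trans (cong φ.from (ψ.from-to _ (φ.to-in x p))) (φ.from-to x p)
    ; to-from = λ y s → trans (cong ψ.to (φ.to-from _ (ψ.from-in y s))) (ψ.to-from y s)
    ; rel-to = λ R v pv r → subst (rel R) (sym (map-∘ ψ.to φ.to v))
                 (ψ.rel-to R (map φ.to v) (allmap φ.to-in pv) (φ.rel-to R v pv r))
    ; rel-from = λ R v pv r → φ.rel-from R v pv
                 (ψ.rel-from R (map φ.to v) (allmap φ.to-in pv)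
                   (subst (rel R) (map-∘ ψ.to φ.to v) r))
    ; fun-pres = λ F v pv → trans (cong ψ.to (φ.fun-pres F v pv))
                   (trans (ψ.fun-pres F (map φ.to v) (allmap φ.to-in pv))
                          (cong (fun F) (sym (map-∘ ψ.to φ.to v))))
    }
    where
      module φ = SubIso φ
      module ψ = SubIso ψ

  Extends : ∀ {P Q} → Aut → SubIso P Q → Set
  Extends {P} σ φ = ∀ x → P x → Aut.to σ x ≡ SubIso.to φ x

  inv : ∀ {P Q} → IsSubstructure P → SubIso P Q → SubIso Q P
  inv {P} {Q} closedP φ = record
    { to = φ.from
    ; from = φ.to
    ; to-in = φ.from-in
    ; from-in = φ.to-in
    ; from-to = φ.to-from
    ; to-from = φ.from-to
    ; rel-to = λ R v qv r → φ.rel-from R (map φ.from v) (allmap φ.from-in qv)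
                 (subst (rel R) (sym (map-inv φ.to-from qv)) r)
    ; rel-from = λ R v qv r → subst (rel R) (map-inv φ.to-from qv)
                 (φ.rel-to R (map φ.from v) (allmap φ.from-in qv) r)
    ; fun-pres = λ F v qv →
        let w = map φ.from v
            pw = allmap φ.from-in qv
        in trans (cong (λ u → φ.from (fun F u)) (sym (map-inv φ.to-from qv)))
           (trans (cong φ.from (sym (φ.fun-pres F w pw)))
                  (φ.from-to (fun F w) (closedP F w pw)))
    }
    where module φ = SubIso φ

-- "the relation _~_ has finitely many classes on the elements satisfying D":
-- a finite list of representatives such that every element of D is related
-- to one of them.
FinitelyManyOrbitsOn : {A : Set} → (A → Set) → (A → A → Set) → Set
FinitelyManyOrbitsOn {A} D _~_ = Σ (List A) λ reps → ∀ a → D a → Any (a ~_) reps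

module _ {L : Signature} (M : Structure L) where
  open Structure M

  AutOrbitRel : ∀ n → Vec Carrier n → Vec Carrier n → Set
  AutOrbitRel n a b = Σ (Aut M) λ σ → map (Aut.to σ) a ≡ b

-- Set extension  N̄ = (N; N₁,…,N_r) of N by a partition into r parts,
-- given by the map sending an element to the index of its part.

record Partitioned {L : Signature} (N : Structure L) : Set where
  field
    r    : ℕ
    part : Structure.Carrier N → Fin r

module _ {L : Signature} {N : Structure L} (P : Partitioned N) where
  open Partitioned P

  AutBar : Set
  AutBar = Σ (Aut N) λ π → ∀ i → part (Aut.to π i) ≡ part i

  AutBarOrbitRel : ∀ n → Vec (Structure.Carrier N) n → Vec (Structure.Carrier N) n → Set
  AutBarOrbitRel n a b = Σ AutBar λ π → map (Aut.to (Data.Product.proj₁ π)) a ≡ b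

  -- N̄ is ℵ₀-categorical: Aut(N̄) has finitely many orbits on N^n for all n ≥ 1
  ℵ₀-categoricalBar : Set
  ℵ₀-categoricalBar = ∀ n → 1 ≤ n →
    FinitelyManyOrbitsOn (λ (_ : Vec (Structure.Carrier N) n) → ⊤) (AutBarOrbitRel n)

record System {L L' : Signature} (M : Structure L) (N : Structure L')
              (N̄ : Partitioned N) : Set₁ where
  open Structure M using (Carrier)
  open Partitioned N̄
  Idx = Structure.Carrier N
  field
    M'      : Carrier → Set
    M'-sub  : IsSubstructure M M'
    Mᵢ      : Idx → Carrier → Set
    Mᵢ-sub  : ∀ i → IsSubstructure M (Mᵢ i)
    Mᵢ⊆M'   : ∀ i x → Mᵢ i x → M' x
    M'⊆⋃Mᵢ  : ∀ x → M' x → Σ Idx λ i → Mᵢ i x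
    Ψ       : ∀ i j → SubIso M (Mᵢ i) (Mᵢ j) → Set
    Ψ-nonempty : ∀ i j → part i ≡ part j → Σ (SubIso M (Mᵢ i) (Mᵢ j)) (Ψ i j)
    Ψ-comp  : ∀ i j l (φ : SubIso M (Mᵢ i) (Mᵢ j)) (φ' : SubIso M (Mᵢ j) (Mᵢ l)) →
              Ψ i j φ → Ψ j l φ' → Ψ i l (_⨾_ M φ φ')
    Ψ-inv   : ∀ i j (φ : SubIso M (Mᵢ i) (Mᵢ j)) →
              Ψ i j φ → Ψ j i (inv M (Mᵢ-sub i) φ)
    Ψ-ext   : ∀ (π : AutBar N̄) →
              (φ : ∀ i → SubIso M (Mᵢ i) (Mᵢ (Aut.to (Data.Product.proj₁ π) i))) →
              (∀ i → Ψ i (Aut.to (Data.Product.proj₁ π) i) (φ i)) →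
              Σ (Aut M) λ σ → ∀ i → Extends M σ (φ i)

  ΨOrbitRel : ∀ i n → Vec Carrier n → Vec Carrier n → Set
  ΨOrbitRel i n a b = Σ (SubIso M (Mᵢ i) (Mᵢ i)) λ φ → Ψ i i φ × map (SubIso.to φ) a ≡ b

  ℵ₀-categoricalOverΨ : Idx → Set
  ℵ₀-categoricalOverΨ i = ∀ n → 1 ≤ n → FinitelyManyOrbitsOn (All (Mᵢ i)) (ΨOrbitRel i n)

module Submission where

-- Say that b lies in the slots j (j a tuple of indices) when b_k ∈ M_{j_k} for all k.
--  * Reduction (move-to-representative): choose slots ī for a tuple a from M'.  Some
--    π ∈ Aut(N̄) carries ī to one of the finitely many Aut(N̄)-orbit representatives j,
--    and condition (4) lifts π to σ ∈ Aut(M) carrying every M_i into M_{iπ}; so aσ lies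
--    in the slots j.
--  * Fixed slots (SlotOrbits.slot-orbits): for b in the slots j and each coordinate m,
--    move b inside M_{j_m} along the maps of Ψ (the "pulled" tuple), and let
--    ψ_m ∈ Ψ_{j_m,j_m} carry it to one of finitely many representatives.  Conjugating ψ_m
--    back to every M_i in the part of j_m and applying (4) with π = id yields an
--    automorphism of M taking b to a tuple determined by the chosen representatives.
--  * The theorem combines the two with a general covering lemma for orbit counts.

open import Defs
open import Data.Nat using (ℕ; _≤_)
open import Data.Vec using (Vec)
open import Data.Vec.Relation.Unary.All using (All)

open import Data.Empty using (⊥-elim)
open import Data.Fin using (Fin; zero; suc) renaming (_≟_ to _≟ᶠ_)
open import Data.Fin.Properties using (any?)
open import Data.List using (List; [_]; concatMap; cartesianProductWith)
import Data.List as List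
open import Data.List.Relation.Unary.Any using (Any; here)
import Data.List.Relation.Unary.Any as Any
open import Data.List.Relation.Unary.Any.Properties using (concatMap⁺; cartesianProductWith⁺; map⁺)
open import Data.Product using (Σ; ∃; _×_; _,_; proj₁; proj₂)
open import Data.Unit using (tt)
open import Data.Vec using (lookup; tabulate; map)
open import Data.Vec.Functional using (Vector)
import Data.Vec.Functional as Vector
open import Data.Vec.Properties using (lookup-map; lookup∘tabulate; tabulate∘lookup; tabulate-∘; tabulate-cong; map-∘; map-id)
open import Data.Vec.Relation.Unary.All.Properties using (lookup⁺; tabulate⁺)
open import Function using (_∘_)
open import Relation.Binary.PropositionalEquality using (_≡_; refl; sym; trans; cong; subst; subst₂; module ≡-Reasoning)
open import Relation.Nullary using (Dec; yes; no)
open import Axiom.UniquenessOfIdentityProofs using (module Decidable⇒UIP)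

choices : ∀ {A : Set} {k} → Vector (List A) k → List (Vector A k)
choices {k = ℕ.zero}  Ls = [ Vector.[] ]
choices {k = ℕ.suc k} Ls = cartesianProductWith Vector._∷_ (Ls zero) (choices (Vector.tail Ls))

any-choices : ∀ {A : Set} {k} (Q : Fin k → A → Set) (Ls : Vector (List A) k) →
  (∀ m → Any (Q m) (Ls m)) → Any (λ R → ∀ m → Q m (R m)) (choices Ls)
any-choices {k = ℕ.zero}  Q Ls found = here (λ ())
any-choices {k = ℕ.suc k} Q Ls found =
  cartesianProductWith⁺ Vector._∷_ (λ q r → λ { zero → q ; (suc m) → r m })
    (found zero) (any-choices (Q ∘ suc) (Vector.tail Ls) (found ∘ suc))

finite-orbits-by-cover : ∀ {A B : Set} {D : A → Set} {_~_ : A → A → Set} →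
  (∀ {a b c} → a ~ b → b ~ c → a ~ c) →
  (xs : List B) (E : B → A → Set) →
  (∀ x → FinitelyManyOrbitsOn (E x) _~_) →
  (∀ a → D a → Any (λ x → Σ A λ b → a ~ b × E x b) xs) →
  FinitelyManyOrbitsOn D _~_
finite-orbits-by-cover ~-trans xs E finite cover =
  concatMap (proj₁ ∘ finite) xs ,
  λ a a∈D → concatMap⁺ (proj₁ ∘ finite)
    (Any.map (λ { {x} (b , a~b , b∈E) → Any.map (~-trans a~b) (proj₂ (finite x) b b∈E) })
      (cover a a∈D))

module _ {L : Signature} (M : Structure L) where
  open Signature L
  open Structure M

  idAut : Aut M
  idAut = record
    { to = λ x → x ; from = λ x → x ; from-to = λ _ → refl ; to-from = λ _ → refl
    ; rel-to = λ R v r → subst (rel R) (sym (map-id v)) r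
    ; rel-from = λ R v r → subst (rel R) (map-id v) r
    ; fun-pres = λ F v → cong (fun F) (sym (map-id v)) }

  _∘Aut_ : Aut M → Aut M → Aut M
  σ ∘Aut τ = record
    { to = τ.to ∘ σ.to
    ; from = σ.from ∘ τ.from
    ; from-to = λ x → trans (cong σ.from (τ.from-to _)) (σ.from-to x)
    ; to-from = λ y → trans (cong τ.to (σ.to-from _)) (τ.to-from y)
    ; rel-to = λ R v r → subst (rel R) (sym (map-∘ τ.to σ.to v))
                 (τ.rel-to R (map σ.to v) (σ.rel-to R v r))
    ; rel-from = λ R v r → σ.rel-from R v
                 (τ.rel-from R (map σ.to v) (subst (rel R) (map-∘ τ.to σ.to v) r))
    ; fun-pres = λ F v → trans (cong τ.to (σ.fun-pres F v))
                   (trans (τ.fun-pres F (map σ.to v)) (cong (fun F) (sym (map-∘ τ.to σ.to v))))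
    }
    where
      module σ = Aut σ
      module τ = Aut τ

  orbit-trans : ∀ {n} {a b c : Vec Carrier n} →
    AutOrbitRel M n a b → AutOrbitRel M n b c → AutOrbitRel M n a c
  orbit-trans {a = a} (σ , refl) (τ , refl) = σ ∘Aut τ , map-∘ (Aut.to τ) (Aut.to σ) a

  extends-on-tuple : ∀ {I : Set} {P Q : I → Carrier → Set}
    (σ : Aut M) (φ : ∀ i → SubIso M (P i) (Q i)) → (∀ i → Extends M σ (φ i)) →
    ∀ {n} (j : Fin n → I) (b : Vec Carrier n) → (∀ k → P (j k) (lookup b k)) →
    map (Aut.to σ) b ≡ tabulate (λ k → SubIso.to (φ (j k)) (lookup b k))
  extends-on-tuple σ φ σ-extends j b b∈P = begin
    map (Aut.to σ) b                         ≡⟨ cong (map (Aut.to σ)) (sym (tabulate∘lookup b)) ⟩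
    map (Aut.to σ) (tabulate (lookup b))     ≡⟨ sym (tabulate-∘ (Aut.to σ) (lookup b)) ⟩
    tabulate (Aut.to σ ∘ lookup b)           ≡⟨ tabulate-cong (λ k → σ-extends (j k) _ (b∈P k)) ⟩
    tabulate (λ k → SubIso.to (φ (j k)) (lookup b k)) ∎
    where open ≡-Reasoning

module _ {L L' : Signature} {M : Structure L} {N : Structure L'} {N̄ : Partitioned N}
         (𝒜 : System M N N̄) where
  open Structure M using (Carrier)
  open Partitioned N̄
  open System 𝒜

  θ : ∀ i j → part i ≡ part j → SubIso M (Mᵢ i) (Mᵢ j)
  θ i j e = proj₁ (Ψ-nonempty i j e)

  θ∈Ψ : ∀ i j e → Ψ i j (θ i j e)
  θ∈Ψ i j e = proj₂ (Ψ-nonempty i j e)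

  -- Parts are elements of Fin r, so θ does not depend on the proof that parts agree.
  θ-irrelevant : ∀ i j (e e' : part i ≡ part j) → θ i j e ≡ θ i j e'
  θ-irrelevant i j e e' = cong (θ i j) (≡-irrelevant e e')
    where open Decidable⇒UIP (_≟ᶠ_ {r}) using (≡-irrelevant)

  conjugate : ∀ i j → part i ≡ part j → SubIso M (Mᵢ j) (Mᵢ j) → SubIso M (Mᵢ i) (Mᵢ i)
  conjugate i j e ψ = _⨾_ M (_⨾_ M (θ i j e) ψ) (inv M (Mᵢ-sub i) (θ i j e))

  conjugate∈Ψ : ∀ i j e ψ → Ψ j j ψ → Ψ i i (conjugate i j e ψ)
  conjugate∈Ψ i j e ψ ψ∈Ψ =
    Ψ-comp i j i _ _ (Ψ-comp i j j _ _ (θ∈Ψ i j e) ψ∈Ψ) (Ψ-inv i j _ (θ∈Ψ i j e))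

  lift : (π : AutBar N̄) →
    Σ (Aut M) λ σ → ∀ i x → Mᵢ i x → Mᵢ (Aut.to (proj₁ π) i) (Aut.to σ x)
  lift (π , π-fixes-parts) = σ , λ i x x∈Mᵢ →
    subst (Mᵢ _) (sym (σ-extends i x x∈Mᵢ)) (SubIso.to-in (θ-along i) x x∈Mᵢ)
    where
      θ-along : ∀ i → SubIso M (Mᵢ i) (Mᵢ (Aut.to π i))
      θ-along i = θ i _ (sym (π-fixes-parts i))
      extension = Ψ-ext (π , π-fixes-parts) θ-along (λ i → θ∈Ψ i _ (sym (π-fixes-parts i)))
      σ = proj₁ extension
      σ-extends = proj₂ extension

  InSlots : ∀ {n} → (Fin n → Idx) → Vec Carrier n → Set
  InSlots j b = ∀ k → Mᵢ (j k) (lookup b k)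

  move-to-representative : (catN : ℵ₀-categoricalBar N̄) → ∀ {n} (n≥1 : 1 ≤ n) →
    ∀ a → All M' a →
    Any (λ j → Σ (Vec Carrier n) λ b → AutOrbitRel M n a b × InSlots (lookup j) b)
        (proj₁ (catN n n≥1))
  move-to-representative catN n≥1 a a∈M' =
    Any.map (λ { {j} (π , π-maps) → moved j π π-maps }) (proj₂ (catN _ n≥1) ī tt)
    where
      slot = λ k → M'⊆⋃Mᵢ (lookup a k) (lookup⁺ a∈M' k)
      ī = tabulate (proj₁ ∘ slot)

      a∈ī : InSlots (lookup ī) a
      a∈ī k = subst (λ i → Mᵢ i (lookup a k)) (sym (lookup∘tabulate (proj₁ ∘ slot) k))
                (proj₂ (slot k))

      moved : ∀ j (π : AutBar N̄) → map (Aut.to (proj₁ π)) ī ≡ j →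
        Σ (Vec Carrier _) λ b → AutOrbitRel M _ a b × InSlots (lookup j) b
      moved _ π refl = map (Aut.to σ) a , (σ , refl) , λ k →
        subst₂ Mᵢ (sym (lookup-map k (Aut.to (proj₁ π)) ī)) (sym (lookup-map k (Aut.to σ) a))
          (σ-maps (lookup ī k) (lookup a k) (a∈ī k))
        where
          σ = proj₁ (lift π)
          σ-maps = proj₂ (lift π)

  module SlotOrbits (catM : ∀ i → ℵ₀-categoricalOverΨ i) {n} (n≥1 : 1 ≤ n)
                    (j : Fin n → Idx) where

    occurrence : ∀ i → Dec (∃ λ m → part i ≡ part (j m))
    occurrence i = any? (λ m → part i ≟ᶠ part (j m))

    -- The k-th entry of b moved into M_{j m}: by θ if j k and j m share a part, otherwise
    -- replaced by the entry b_m (which lies in M_{j m}).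
    pull : Vec Carrier n → ∀ m k → Dec (part (j k) ≡ part (j m)) → Carrier
    pull b m k (yes e) = SubIso.to (θ (j k) (j m) e) (lookup b k)
    pull b m k (no _)  = lookup b m

    pulled : Vec Carrier n → Fin n → Vec Carrier n
    pulled b m = tabulate λ k → pull b m k (part (j k) ≟ᶠ part (j m))

    pulled-in : ∀ b → InSlots j b → ∀ m → All (Mᵢ (j m)) (pulled b m)
    pulled-in b b∈j m = tabulate⁺ λ k → pull-in k (part (j k) ≟ᶠ part (j m))
      where
        pull-in : ∀ k s → Mᵢ (j m) (pull b m k s)
        pull-in k (yes e) = SubIso.to-in (θ (j k) (j m) e) (lookup b k) (b∈j k)
        pull-in k (no _)  = b∈j m

    pulled-at : ∀ b m k (e : part (j k) ≡ part (j m)) →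
      lookup (pulled b m) k ≡ SubIso.to (θ (j k) (j m) e) (lookup b k)
    pulled-at b m k e = trans (lookup∘tabulate _ k) (pull-at (part (j k) ≟ᶠ part (j m)))
      where
        pull-at : ∀ s → pull b m k s ≡ SubIso.to (θ (j k) (j m) e) (lookup b k)
        pull-at (yes e') = cong (λ φ → SubIso.to φ (lookup b k)) (θ-irrelevant _ _ e' e)
        pull-at (no e≢)  = ⊥-elim (e≢ e)

    unpull : (Fin n → Vec Carrier n) → ∀ k → Dec (∃ λ m → part (j k) ≡ part (j m)) → Carrier
    unpull R k (yes (m , e)) = SubIso.from (θ (j k) (j m) e) (lookup (R m) k)
    unpull R k (no absent)   = ⊥-elim (absent (k , refl))

    representative : (Fin n → Vec Carrier n) → Vec Carrier n
    representative R = tabulate λ k → unpull R k (occurrence (j k))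

    candidates : List (Vec Carrier n)
    candidates = List.map representative (choices λ m → proj₁ (catM (j m) n n≥1))

    to-representative : ∀ b → InSlots j b → (R : Fin n → Vec Carrier n) →
      (∀ m → ΨOrbitRel (j m) n (pulled b m) (R m)) → AutOrbitRel M n b (representative R)
    to-representative b b∈j R ψ =
      σ , trans (extends-on-tuple M σ (λ i → φ i (occurrence i)) σ-extends j b b∈j)
                (tabulate-cong λ k → φ-acts k (occurrence (j k)))
      where
        φ : ∀ i → Dec (∃ λ m → part i ≡ part (j m)) → SubIso M (Mᵢ i) (Mᵢ i)
        φ i (yes (m , e)) = conjugate i (j m) e (proj₁ (ψ m))
        φ i (no _)        = θ i i refl

        φ∈Ψ : ∀ i s → Ψ i i (φ i s)
        φ∈Ψ i (yes (m , e)) = conjugate∈Ψ i (j m) e _ (proj₁ (proj₂ (ψ m)))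
        φ∈Ψ i (no _)        = θ∈Ψ i i refl

        extension = Ψ-ext (idAut N , λ _ → refl) (λ i → φ i (occurrence i))
                          (λ i → φ∈Ψ i (occurrence i))
        σ = proj₁ extension
        σ-extends = proj₂ extension

        φ-acts : ∀ k s → SubIso.to (φ (j k) s) (lookup b k) ≡ unpull R k s
        φ-acts k (yes (m , e)) = cong (SubIso.from (θ (j k) (j m) e)) (begin
          ψ.to (SubIso.to (θ (j k) (j m) e) (lookup b k)) ≡⟨ cong ψ.to (sym (pulled-at b m k e)) ⟩
          ψ.to (lookup (pulled b m) k)                   ≡⟨ sym (lookup-map k ψ.to (pulled b m)) ⟩
          lookup (map ψ.to (pulled b m)) k               ≡⟨ cong (λ v → lookup v k) (proj₂ (proj₂ (ψ m))) ⟩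
          lookup (R m) k                                 ∎)
          where
            open ≡-Reasoning
            module ψ = SubIso (proj₁ (ψ m))
        φ-acts k (no absent) = ⊥-elim (absent (k , refl))

    slot-orbits : FinitelyManyOrbitsOn (InSlots j) (AutOrbitRel M n)
    slot-orbits = candidates , λ b b∈j →
      map⁺ (Any.map (λ {R} → to-representative b b∈j R)
        (any-choices (λ m → ΨOrbitRel (j m) n (pulled b m)) _
          (λ m → proj₂ (catM (j m) n n≥1) (pulled b m) (pulled-in b b∈j m))))

lemma3p4 : {L L' : Signature} (M : Structure L) (N : Structure L') (N̄ : Partitioned N)
    (𝒜 : System M N N̄) →
    Countable M →
    ℵ₀-categoricalBar N̄ →
    (∀ i → System.ℵ₀-categoricalOverΨ 𝒜 i) →
    ∀ n → 1 ≤ n →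
    FinitelyManyOrbitsOn (All (System.M' 𝒜)) (AutOrbitRel M n)
lemma3p4 M N N̄ 𝒜 _ catN catM n n≥1 =
  finite-orbits-by-cover (orbit-trans M) (proj₁ (catN n n≥1))
    (λ j → InSlots 𝒜 (lookup j))
    (λ j → SlotOrbits.slot-orbits 𝒜 catM n≥1 (lookup j))
    (move-to-representative 𝒜 catN n≥1)
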